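{- Let $n,b$ be integers with $\gcd(b,n)=\gcd(n,6)=1$, and let $H$ be a positive integer. Then for every integer $h_2\in[-H,H]$ there exists at most one integer $\tilde h_2\in[-H,H]$ such that $\gcd(bh_2+\tilde h_2,n)>\sqrt{2Hn}$. Furthermore, for every integer $\tilde h_2\in[-H,H]$ there exists at most one integer $h_2\in[-H,H]$ such that $\gcd(bh_2+\tilde h_2,n)>\sqrt{2Hn}$. -}

module Defs where

open import Data.Integer using (ℤ; _*_; _<_; _≤_; -_; +_)
open import Data.Product using (_×_)

-- For g ≥ 0 and m ≥ 0 :  g > √m  ⇔  m < g²   (sqrt comparison over ℤ, no reals)
_>√_ : ℤ → ℤ → Set
g >√ m = m < g * g

InRange : ℤ → ℤ → Set
InRange H x = (- H ≤ x) × (x ≤ H)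

{-# OPTIONS --safe #-}

-- Let d₁ = gcd(x, n) and d₂ = gcd(y, n) both exceed √(2Hn). Then
-- gcd(d₁, d₂) · lcm(d₁, d₂) = d₁ d₂ > 2Hn while lcm(d₁, d₂) ∣ n, so g = gcd(d₁, d₂) > 2H.
-- This g divides x − y, which is t − t′ or b(h₂ − h₂′); as g ∣ n it is coprime to b,
-- so g divides an integer of absolute value at most 2H < g, which must be 0.

module Submission where

open import Defs
open import Data.Integer using (ℤ; _*_; _+_; _<_; +_; 0ℤ)
open import Data.Integer.GCD using (gcd)
open import Data.Product using (_×_)
open import Relation.Binary.PropositionalEquality using (_≡_)

open import Data.Integer as ℤ using (_-_; ∣_∣; 1ℤ; -[1+_]; +≤+; -≤-; +<+)
import Data.Integer.Properties as ℤ
import Data.Integer.Divisibility.Signed as ℤ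
import Data.Integer.GCD as ℤ
open import Data.Integer.Tactic.RingSolver using (solve-∀)
open import Data.Nat as ℕ using (ℕ; zero; suc; s≤s; NonZero; >-nonZero)
import Data.Nat.Properties as ℕ
open import Data.Nat.Divisibility using (_∣_; ∣-trans; ∣⇒≤; >⇒∤)
open import Data.Nat.GCD using (gcd[m,n]∣m; gcd[m,n]∣n)
import Data.Nat.GCD as ℕ
open import Data.Nat.LCM using (lcm; lcm-least; gcd*lcm)
open import Data.Nat.Coprimality as Coprimality using (Coprime; gcd≡1⇒coprime; coprime-divisor)
open import Data.Product using (_,_)
open import Data.Sum using (inj₁; inj₂)
open import Relation.Binary.PropositionalEquality using (refl; sym; trans; cong; subst; subst₂)
open import Function using (_∘_)
open import Relation.Nullary using (contradiction)

<-squares⇒<-* : ∀ {x} a b → x ℕ.< a ℕ.* a → x ℕ.< b ℕ.* b → x ℕ.< a ℕ.* b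
<-squares⇒<-* a b x<a² x<b² with ℕ.≤-total a b
... | inj₁ a≤b = ℕ.<-≤-trans x<a² (ℕ.*-monoʳ-≤ a a≤b)
... | inj₂ b≤a = ℕ.<-≤-trans x<b² (ℕ.*-monoˡ-≤ b b≤a)

large-divisors⇒large-gcd : ∀ {k m d₁ d₂} .{{_ : NonZero m}} → d₁ ∣ m → d₂ ∣ m →
  k ℕ.* m ℕ.< d₁ ℕ.* d₁ → k ℕ.* m ℕ.< d₂ ℕ.* d₂ → k ℕ.< ℕ.gcd d₁ d₂
large-divisors⇒large-gcd {k} {m} {d₁} {d₂} d₁∣m d₂∣m km<d₁² km<d₂² =
  ℕ.*-cancelʳ-< m k (ℕ.gcd d₁ d₂) (begin-strict
    k ℕ.* m                       <⟨ <-squares⇒<-* d₁ d₂ km<d₁² km<d₂² ⟩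
    d₁ ℕ.* d₂                     ≡⟨ gcd*lcm d₁ d₂ ⟨
    ℕ.gcd d₁ d₂ ℕ.* lcm d₁ d₂     ≤⟨ ℕ.*-monoʳ-≤ (ℕ.gcd d₁ d₂) (∣⇒≤ (lcm-least d₁∣m d₂∣m)) ⟩
    ℕ.gcd d₁ d₂ ℕ.* m             ∎)
  where open ℕ.≤-Reasoning

∣∧<⇒≡0 : ∀ {d n} → d ∣ n → n ℕ.< d → n ≡ 0
∣∧<⇒≡0 {n = zero}  _   _   = refl
∣∧<⇒≡0 {n = suc _} d∣n n<d = contradiction d∣n (>⇒∤ n<d)

coprime-∣ʳ : ∀ {a m d} → Coprime a m → d ∣ m → Coprime a d
coprime-∣ʳ a⊥m d∣m (i∣a , i∣d) = a⊥m (i∣a , ∣-trans i∣d d∣m)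

>√⇒< : ∀ a b c g → (+ g) >√ (+ a * + b * + c) → a ℕ.* b ℕ.* c ℕ.< g ℕ.* g
>√⇒< a b c g = ℤ.drop‿+<+ ∘ subst₂ _<_ abc≡ (sym (ℤ.pos-* g g))
  where
  abc≡ : + a * + b * + c ≡ + (a ℕ.* b ℕ.* c)
  abc≡ = trans (cong (_* + c) (sym (ℤ.pos-* a b))) (sym (ℤ.pos-* (a ℕ.* b) c))

InRange⇒∣i∣≤ : ∀ {h i} → InRange (+ h) i → ∣ i ∣ ℕ.≤ h
InRange⇒∣i∣≤ {i = + _}               (_ , +≤+ k≤h) = k≤h
InRange⇒∣i∣≤ {h = zero}  { -[1+ _ ]} (() , _)
InRange⇒∣i∣≤ {h = suc _} { -[1+ _ ]} (-≤- k≤h , _) = s≤s k≤h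

InRange⇒∣i-j∣≤ : ∀ {h i j} → InRange (+ h) i → InRange (+ h) j → ∣ i - j ∣ ℕ.≤ 2 ℕ.* h
InRange⇒∣i-j∣≤ {h} {i} {j} i∈ j∈ = begin
  ∣ i - j ∣          ≤⟨ ℤ.∣i-j∣≤∣i∣+∣j∣ i j ⟩
  ∣ i ∣ ℕ.+ ∣ j ∣    ≤⟨ ℕ.+-mono-≤ (InRange⇒∣i∣≤ i∈) (InRange⇒∣i∣≤ j∈) ⟩
  h ℕ.+ h            ≡⟨ cong (h ℕ.+_) (ℕ.+-identityʳ h) ⟨
  2 ℕ.* h            ∎
  where open ℕ.≤-Reasoning

∣∣i∣∧∣∣j∣⇒∣∣i-j∣ : ∀ {d} i j → d ∣ ∣ i ∣ → d ∣ ∣ j ∣ → d ∣ ∣ i - j ∣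
∣∣i∣∧∣∣j∣⇒∣∣i-j∣ {d} i j d∣i d∣j =
  ℤ.∣⇒∣ᵤ {k = + d} (ℤ.∣m∣n⇒∣m-n (ℤ.∣ᵤ⇒∣ {k = + d} {i} d∣i) (ℤ.∣ᵤ⇒∣ {k = + d} {j} d∣j))

large-gcds⇒cancel : ∀ {h m} .{{_ : NonZero m}} (c x y u v : ℤ) →
  gcd c (+ m) ≡ + 1 → x - y ≡ c * (u - v) → InRange (+ h) u → InRange (+ h) v →
  gcd x (+ m) >√ (+ 2 * + h * + m) → gcd y (+ m) >√ (+ 2 * + h * + m) → u ≡ v
large-gcds⇒cancel {h} {m} c x y u v c⊥m x-y≡c[u-v] u∈ v∈ x-large y-large =
  ℤ.i-j≡0⇒i≡j u v (ℤ.∣i∣≡0⇒i≡0 (∣∧<⇒≡0 g∣∣u-v∣ (ℕ.≤-<-trans (InRange⇒∣i-j∣≤ u∈ v∈) 2h<g)))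
  where
  d₁ d₂ g : ℕ
  d₁ = ℕ.gcd ∣ x ∣ m
  d₂ = ℕ.gcd ∣ y ∣ m
  g = ℕ.gcd d₁ d₂

  g∣m : g ∣ m
  g∣m = ∣-trans (gcd[m,n]∣m d₁ d₂) (gcd[m,n]∣n ∣ x ∣ m)

  2h<g : 2 ℕ.* h ℕ.< g
  2h<g = large-divisors⇒large-gcd (gcd[m,n]∣n ∣ x ∣ m) (gcd[m,n]∣n ∣ y ∣ m)
    (>√⇒< 2 h m d₁ x-large) (>√⇒< 2 h m d₂ y-large)

  g∣∣x-y∣ : g ∣ ∣ x - y ∣
  g∣∣x-y∣ = ∣∣i∣∧∣∣j∣⇒∣∣i-j∣ x y
    (∣-trans (gcd[m,n]∣m d₁ d₂) (gcd[m,n]∣m ∣ x ∣ m))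
    (∣-trans (gcd[m,n]∣n d₁ d₂) (gcd[m,n]∣m ∣ y ∣ m))

  g⊥c : Coprime g ∣ c ∣
  g⊥c = Coprimality.sym (coprime-∣ʳ (gcd≡1⇒coprime (ℤ.+-injective c⊥m)) g∣m)

  g∣∣u-v∣ : g ∣ ∣ u - v ∣
  g∣∣u-v∣ = coprime-divisor g⊥c
    (subst (g ∣_) (trans (cong ∣_∣ x-y≡c[u-v]) (ℤ.∣i*j∣≡∣i∣*∣j∣ c (u - v))) g∣∣x-y∣)

lemma3p2 : (n b H : ℤ) → 0ℤ < n → gcd b n ≡ + 1 → gcd n (+ 6) ≡ + 1 → 0ℤ < H →
    ((h₂ t t′ : ℤ) → InRange H h₂ → InRange H t → InRange H t′ →
      gcd (b * h₂ + t) n >√ (+ 2 * H * n) → gcd (b * h₂ + t′) n >√ (+ 2 * H * n) → t ≡ t′)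
    × ((t h₂ h₂′ : ℤ) → InRange H t → InRange H h₂ → InRange H h₂′ →
      gcd (b * h₂ + t) n >√ (+ 2 * H * n) → gcd (b * h₂′ + t) n >√ (+ 2 * H * n) → h₂ ≡ h₂′)
lemma3p2 (+ m) b (+ h) (+<+ 0<m) b⊥n _ (+<+ _) =
  (λ h₂ t t′ _ t∈ t′∈ → large-gcds⇒cancel 1ℤ (b * h₂ + t) (b * h₂ + t′) t t′
    (ℤ.gcd-zeroˡ (+ m)) (differ-in-t b h₂ t t′) t∈ t′∈)
  , (λ t h₂ h₂′ _ h₂∈ h₂′∈ → large-gcds⇒cancel b (b * h₂ + t) (b * h₂′ + t) h₂ h₂′
    b⊥n (differ-in-h₂ b h₂ h₂′ t) h₂∈ h₂′∈)
  where
  instance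
    m≢0 : NonZero m
    m≢0 = >-nonZero 0<m

  differ-in-t : ∀ b h₂ t t′ → (b * h₂ + t) - (b * h₂ + t′) ≡ 1ℤ * (t - t′)
  differ-in-t = solve-∀

  differ-in-h₂ : ∀ b h₂ h₂′ t → (b * h₂ + t) - (b * h₂′ + t) ≡ b * (h₂ - h₂′)
  differ-in-h₂ = solve-∀
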